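{- Let $\mathcal{A}=(A,\mapsto)$ be a PARS that is distribution confluent. Then $\mathcal{A}$ has unique terminal distributions: for every $a\in A$ and all maximal computation trees $T_1,T_2\in\mathcal{T}(a)$, $\mathrm{supp}(T_1)\approx\mathrm{supp}(T_2)$.
   Context: For a set $A$, $\mathrm{Dist}(A)$ is the set of finite lists of pairs $(p,a)$ with $p\in\mathbb{R}^+$ and $a\in A$; $[\,]$ empty list, $::$ cons, $++$ concatenation; $\mathrm{Dist}_1(A)$ the lists whose weights sum to $1$; $\alpha[(p_i,a_i)]_i=[(\alpha p_i,a_i)]_i$. A PARS is a pair $(A,\mapsto)$ with $\mapsto\subseteq A\times\mathrm{Dist}_1(A)$. An element $a$ is terminal if there is no $E$ with $a\mapsto E$. Computation trees: $a\in\mathcal{T}(a)$; if $a\mapsto[(p_1,a_1),\dots,(p_n,a_n)]$ and $t_i\in\mathcal{T}(a_i)$ then $[a;(p_1,t_1);\dots;(p_n,t_n)]\in\mathcal{T}(a)$ (finite trees, inductively). $\mathrm{supp}(a)=[(1,a)]$, $\mathrm{supp}([a;(p_1,t_1);\dots;(p_n,t_n)])=p_1\mathrm{supp}(t_1)++\cdots++p_n\mathrm{supp}(t_n)$. A tree is maximal if all its leaves are terminal elements. The relation $\sim$ is the smallest relation on $\mathrm{Dist}(A)$ containing $[(p,a),(q,b)]\sim[(q,b),(p,a)]$, $[(p,a),(q,a)]\sim[(p+q,a)]$, $[(p+q,a)]\sim[(p,a),(q,a)]$ and closed under $D\sim D'\Rightarrow E_1++D++E_2\sim E_1++D'++E_2$;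 $\approx$ is its reflexive-transitive closure. Parallel evolution $\to_P$: $[\,]\to_P[\,]$; if $ds\to_P ds'$ then $(p,a)::ds\to_P(p,a)::ds'$; if $a\mapsto E$ and $ds\to_P ds'$ then $(p,a)::ds\to_P pE++ds'$. Let $\twoheadrightarrow\;=\;\to_P\cup\approx$. $\mathcal{A}$ is distribution confluent if $\twoheadrightarrow$ is confluent, i.e. whenever $D\twoheadrightarrow^*E$ and $D\twoheadrightarrow^*F$ there is $C$ with $E\twoheadrightarrow^*C$ and $F\twoheadrightarrow^*C$ ($^*$ = reflexive-transitive closure). -}

module Defs where

open import Level using (0ℓ)
open import Data.Product using (Σ; ∃; _×_; _,_; proj₁; proj₂)
open import Data.Sum using (_⊎_)
open import Data.List using (List; []; _∷_; _++_; map; foldr)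
open import Relation.Binary.PropositionalEquality using (_≡_; subst; sym)
open import Relation.Binary.Core using (Rel)
open import Relation.Binary.Structures using (IsStrictTotalOrder)
open import Relation.Binary.Construct.Closure.ReflexiveTransitive using (Star)
open import Relation.Nullary using (¬_)
open import Algebra.Structures using (IsCommutativeRing)

-- The real numbers, given axiomatically as a complete ordered field
-- (with propositional equality).  Every model is isomorphic to ℝ.

record Reals : Set₁ where
  infixl 6 _+_
  infixl 7 _*_
  infix 4 _<_
  field
    ℝ   : Set
    0ℝ 1ℝ : ℝ
    _+_ _*_ : ℝ → ℝ → ℝ
    -_  : ℝ → ℝ
    _<_ : Rel ℝ 0ℓ
    isCommutativeRing  : IsCommutativeRing _≡_ _+_ _*_ -_ 0ℝ 1ℝ
    inverse            : ∀ x → ¬ (x ≡ 0ℝ) → Σ ℝ (λ y → x * y ≡ 1ℝ)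
    isStrictTotalOrder : IsStrictTotalOrder _≡_ _<_
    0<1                : 0ℝ < 1ℝ
    +-mono-<           : ∀ {x y} z → x < y → x + z < y + z
    *-pos              : ∀ {x y} → 0ℝ < x → 0ℝ < y → 0ℝ < x * y
    -- the order relation is proposition-valued (as for the classical reals)
    <-irrelevant       : ∀ {x y} (p q : x < y) → p ≡ q
    complete : (S : ℝ → Set) → ∃ S →
               ∃ (λ b → ∀ x → S x → (x < b ⊎ x ≡ b)) →
               ∃ (λ s → (∀ x → S x → (x < s ⊎ x ≡ s)) ×
                        (∀ b → (∀ x → S x → (x < b ⊎ x ≡ b)) → (s < b ⊎ s ≡ b)))

module WithReals (R : Reals) where
  open Reals R
  open IsCommutativeRing isCommutativeRing using (+-identityˡ)
  open IsStrictTotalOrder isStrictTotalOrder using (trans)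

  ℝ⁺ : Set
  ℝ⁺ = Σ ℝ (λ x → 0ℝ < x)

  1⁺ : ℝ⁺
  1⁺ = 1ℝ , 0<1

  _+⁺_ : ℝ⁺ → ℝ⁺ → ℝ⁺
  (p , 0<p) +⁺ (q , 0<q) =
    p + q , trans 0<q (subst (_< p + q) (+-identityˡ q) (+-mono-< q 0<p))

  _*⁺_ : ℝ⁺ → ℝ⁺ → ℝ⁺
  (p , 0<p) *⁺ (q , 0<q) = p * q , *-pos 0<p 0<q

  Dist : Set → Set
  Dist A = List (ℝ⁺ × A)

  weight : {A : Set} → Dist A → ℝ
  weight = foldr (λ pa w → proj₁ (proj₁ pa) + w) 0ℝ

  infixr 7 _·_
  _·_ : {A : Set} → ℝ⁺ → Dist A → Dist A
  α · D = map (λ pa → (α *⁺ proj₁ pa , proj₂ pa)) D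

  infix 4 _~_ _≈_
  data _~_ {A : Set} : Dist A → Dist A → Set where
    swap  : ∀ p a q b → ((p , a) ∷ (q , b) ∷ []) ~ ((q , b) ∷ (p , a) ∷ [])
    merge : ∀ p q a → ((p , a) ∷ (q , a) ∷ []) ~ ((p +⁺ q , a) ∷ [])
    split : ∀ p q a → ((p +⁺ q , a) ∷ []) ~ ((p , a) ∷ (q , a) ∷ [])
    ctx   : ∀ {D D'} E₁ E₂ → D ~ D' → (E₁ ++ D ++ E₂) ~ (E₁ ++ D' ++ E₂)

  _≈_ : {A : Set} → Dist A → Dist A → Set
  _≈_ = Star _~_

  record PARS : Set₁ where
    infix 4 _↦_
    field
      A      : Set
      _↦_    : A → Dist A → Set
      ↦-Dist₁ : ∀ {a E} → a ↦ E → weight E ≡ 1ℝ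

  module OnPARS (𝒜 : PARS) where
    open PARS 𝒜

    Terminal : A → Set
    Terminal a = ¬ (∃ λ E → a ↦ E)

    mutual
      data 𝒯 : A → Set where
        leaf : ∀ a → 𝒯 a
        node : ∀ {a E} → a ↦ E → Subtrees E → 𝒯 a

      data Subtrees : Dist A → Set where
        []  : Subtrees []
        _∷_ : ∀ {p b E} → 𝒯 b → Subtrees E → Subtrees ((p , b) ∷ E)

    mutual
      supp : ∀ {a} → 𝒯 a → Dist A
      supp (leaf a)    = (1⁺ , a) ∷ []
      supp (node _ ts) = supps ts

      supps : ∀ {E} → Subtrees E → Dist A
      supps [] = []
      supps (_∷_ {p} t ts) = p · supp t ++ supps ts

    mutual
      Maximal : ∀ {a} → 𝒯 a → Set
      Maximal (leaf a)    = Terminal a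
      Maximal (node _ ts) = AllMaximal ts

      AllMaximal : ∀ {E} → Subtrees E → Set
      AllMaximal []       = Data.Unit.⊤ where import Data.Unit
      AllMaximal (t ∷ ts) = Maximal t × AllMaximal ts

    infix 4 _→P_ _↠_
    data _→P_ : Dist A → Dist A → Set where
      []   : [] →P []
      stay : ∀ {ds ds'} p a → ds →P ds' → ((p , a) ∷ ds) →P ((p , a) ∷ ds')
      step : ∀ {ds ds' E} p a → a ↦ E → ds →P ds' → ((p , a) ∷ ds) →P (p · E ++ ds')

    _↠_ : Dist A → Dist A → Set
    D ↠ E = D →P E ⊎ D ≈ E

    _↠*_ : Dist A → Dist A → Set
    _↠*_ = Star _↠_

    DistributionConfluent : Set
    DistributionConfluent =
      ∀ {D E F} → D ↠* E → D ↠* F → ∃ λ C → (E ↠* C) × (F ↠* C)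

-- Starting from the one-point distribution [(1,a)], one parallel step per node replays a
-- computation tree, so the supports of both maximal trees are ↠*-reducts of [(1,a)].
-- Confluence gives a common reduct C. A distribution of terminal elements admits only the
-- trivial parallel step and ≈ preserves terminality, so each support reaches C by ≈ alone;
-- as ≈ is symmetric, the two supports are ≈-equivalent.
module Submission where

open import Defs
open import Function using (_∘_)
open import Relation.Binary.PropositionalEquality using (_≡_; refl; cong; subst; subst₂; sym; trans; module ≡-Reasoning)
open import Data.Product using (_,_; proj₁; proj₂)
open import Data.Sum using (inj₁; inj₂)
import Data.Sum as Sum
open import Data.List using ([]; _∷_; _++_)
open import Data.List.Properties using (++-assoc; ++-identityʳ; map-++; map-∘; map-cong; map-id)
open import Data.List.Relation.Unary.All using (All; []; _∷_)
open import Data.List.Relation.Unary.All.Properties using (++⁺; ++⁻)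
open import Relation.Binary.Construct.Closure.ReflexiveTransitive using (ε; _◅_; _◅◅_; gmap; reverse)
open import Algebra.Structures using (IsCommutativeRing)
open import Data.Empty using (⊥-elim)

module Distributions (R : Reals) where
  open Reals R
  open WithReals R
  open IsCommutativeRing isCommutativeRing using (*-assoc; *-identityˡ; *-identityʳ)

  private variable
    X : Set
    D D' : Dist X

  ℝ⁺-≡ : {x y : ℝ⁺} → proj₁ x ≡ proj₁ y → x ≡ y
  ℝ⁺-≡ {x , p} {.x , q} refl = cong (x ,_) (<-irrelevant p q)

  *⁺-identityˡ : ∀ p → 1⁺ *⁺ p ≡ p
  *⁺-identityˡ p = ℝ⁺-≡ (*-identityˡ (proj₁ p))

  *⁺-identityʳ : ∀ p → p *⁺ 1⁺ ≡ p
  *⁺-identityʳ p = ℝ⁺-≡ (*-identityʳ (proj₁ p))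

  ·-distrib-++ : ∀ q (D F : Dist X) → q · (D ++ F) ≡ q · D ++ q · F
  ·-distrib-++ q = map-++ _

  ·-assoc : ∀ q r (D : Dist X) → q · (r · D) ≡ (q *⁺ r) · D
  ·-assoc q r D = trans (sym (map-∘ D)) (map-cong reassociate D)
    where
    reassociate : ∀ pa → (q *⁺ (r *⁺ proj₁ pa) , proj₂ pa) ≡ ((q *⁺ r) *⁺ proj₁ pa , proj₂ pa)
    reassociate (p , a) = cong (_, a) (ℝ⁺-≡ (sym (*-assoc (proj₁ q) (proj₁ r) (proj₁ p))))

  ·-identityˡ : (D : Dist X) → 1⁺ · D ≡ D
  ·-identityˡ D = trans (map-cong unit D) (map-id D)
    where
    unit : ∀ pa → (1⁺ *⁺ proj₁ pa , proj₂ pa) ≡ pa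
    unit (p , a) = cong (_, a) (*⁺-identityˡ p)

  ~-sym : D ~ D' → D' ~ D
  ~-sym (swap p a q b) = swap q b p a
  ~-sym (merge p q a)  = split p q a
  ~-sym (split p q a)  = merge p q a
  ~-sym (ctx E₁ E₂ s)  = ctx E₁ E₂ (~-sym s)

  ≈-sym : D ≈ D' → D' ≈ D
  ≈-sym = reverse ~-sym

  ~-++ˡ : (F : Dist X) → D ~ D' → (F ++ D) ~ (F ++ D')
  ~-++ˡ {D = D} {D' = D'} F s =
    subst₂ (λ E E' → (F ++ E) ~ (F ++ E')) (++-identityʳ D) (++-identityʳ D') (ctx F [] s)

  ≈-++ˡ : (F : Dist X) → D ≈ D' → (F ++ D) ≈ (F ++ D')
  ≈-++ˡ F = gmap (F ++_) (~-++ˡ F)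

  ≈-++ʳ : (F : Dist X) → D ≈ D' → (D ++ F) ≈ (D' ++ F)
  ≈-++ʳ F = gmap (_++ F) (ctx [] F)

module Confluence (R : Reals) (𝒜 : WithReals.PARS R) where
  open WithReals R
  open PARS 𝒜
  open OnPARS 𝒜
  open Distributions R

  →P-refl : ∀ D → D →P D
  →P-refl []            = []
  →P-refl ((p , a) ∷ D) = stay p a (→P-refl D)

  →P-++ : ∀ {D D' F F'} → D →P D' → F →P F' → (D ++ F) →P (D' ++ F')
  →P-++ [] f           = f
  →P-++ (stay p a d) f = stay p a (→P-++ d f)
  →P-++ {F' = F'} (step {ds' = D'} {E = E} p a h d) f =
    subst (_ →P_) (sym (++-assoc (p · E) D' F')) (step p a h (→P-++ d f))

  ↠*-++ˡ : ∀ {D D'} F → D ↠* D' → (F ++ D) ↠* (F ++ D')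
  ↠*-++ˡ F = gmap (F ++_) (Sum.map (→P-++ (→P-refl F)) (≈-++ˡ F))

  ↠*-++ʳ : ∀ {D D'} F → D ↠* D' → (D ++ F) ↠* (D' ++ F)
  ↠*-++ʳ F = gmap (_++ F) (Sum.map (λ d → →P-++ d (→P-refl F)) (≈-++ʳ F))

  ↠*-++ : ∀ {D D' F F'} → D ↠* D' → F ↠* F' → (D ++ F) ↠* (D' ++ F')
  ↠*-++ {D' = D'} {F = F} d f = ↠*-++ʳ F d ◅◅ ↠*-++ˡ D' f

  mutual
    ↠*-supp : ∀ s {b} (t : 𝒯 b) → ((s , b) ∷ []) ↠* (s · supp t)
    ↠*-supp s (leaf b) =
      subst (λ s' → ((s , b) ∷ []) ↠* ((s' , b) ∷ [])) (sym (*⁺-identityʳ s)) ε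
    ↠*-supp s {b} (node {E = E} h ts) =
      inj₁ (subst (((s , b) ∷ []) →P_) (++-identityʳ (s · E)) (step s b h [])) ◅ ↠*-supps s ts

    ↠*-supps : ∀ q {E} (ts : Subtrees E) → (q · E) ↠* (q · supps ts)
    ↠*-supps q [] = ε
    ↠*-supps q (_∷_ {p = r} {E = E} t ts) =
      subst ((q · ((r , _) ∷ E)) ↠*_) (sym scaled-supps) (↠*-++ (↠*-supp (q *⁺ r) t) (↠*-supps q ts))
      where
      open ≡-Reasoning
      scaled-supps : q · (r · supp t ++ supps ts) ≡ (q *⁺ r) · supp t ++ q · supps ts
      scaled-supps = begin
        q · (r · supp t ++ supps ts)       ≡⟨ ·-distrib-++ q (r · supp t) (supps ts) ⟩
        q · (r · supp t) ++ q · supps ts   ≡⟨ cong (_++ q · supps ts) (·-assoc q r (supp t)) ⟩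
        (q *⁺ r) · supp t ++ q · supps ts  ∎

  ↠*-supp₁ : ∀ {a} (t : 𝒯 a) → ((1⁺ , a) ∷ []) ↠* supp t
  ↠*-supp₁ t = subst (_ ↠*_) (·-identityˡ (supp t)) (↠*-supp 1⁺ t)

  AllTerminal : Dist A → Set
  AllTerminal = All (Terminal ∘ proj₂)

  AllTerminal-· : ∀ q {D} → AllTerminal D → AllTerminal (q · D)
  AllTerminal-· q []       = []
  AllTerminal-· q (x ∷ xs) = x ∷ AllTerminal-· q xs

  mutual
    Maximal⇒AllTerminal-supp : ∀ {a} (t : 𝒯 a) → Maximal t → AllTerminal (supp t)
    Maximal⇒AllTerminal-supp (leaf a) m     = m ∷ []
    Maximal⇒AllTerminal-supp (node _ ts) ms = AllMaximal⇒AllTerminal-supps ts ms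

    AllMaximal⇒AllTerminal-supps : ∀ {E} (ts : Subtrees E) → AllMaximal ts → AllTerminal (supps ts)
    AllMaximal⇒AllTerminal-supps [] _ = []
    AllMaximal⇒AllTerminal-supps (_∷_ {p = p} t ts) (m , ms) =
      ++⁺ (AllTerminal-· p (Maximal⇒AllTerminal-supp t m)) (AllMaximal⇒AllTerminal-supps ts ms)

  AllTerminal-~ : ∀ {D D'} → D ~ D' → AllTerminal D → AllTerminal D'
  AllTerminal-~ (swap p a q b) (x ∷ y ∷ []) = y ∷ x ∷ []
  AllTerminal-~ (merge p q a)  (x ∷ _ ∷ []) = x ∷ []
  AllTerminal-~ (split p q a)  (x ∷ [])     = x ∷ x ∷ []
  AllTerminal-~ (ctx E₁ E₂ s) ts with ++⁻ E₁ ts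
  ... | ts₁ , ts₂ with ++⁻ _ ts₂
  ... | ts₃ , ts₄ = ++⁺ ts₁ (++⁺ (AllTerminal-~ s ts₃) ts₄)

  AllTerminal-≈ : ∀ {D D'} → D ≈ D' → AllTerminal D → AllTerminal D'
  AllTerminal-≈ ε        ts = ts
  AllTerminal-≈ (s ◅ ss) ts = AllTerminal-≈ ss (AllTerminal-~ s ts)

  AllTerminal-→P⇒≡ : ∀ {D D'} → D →P D' → AllTerminal D → D ≡ D'
  AllTerminal-→P⇒≡ [] _                = refl
  AllTerminal-→P⇒≡ (stay p a d) (_ ∷ ts) = cong (_ ∷_) (AllTerminal-→P⇒≡ d ts)
  AllTerminal-→P⇒≡ (step p a h d) (x ∷ _) = ⊥-elim (x (_ , h))

  AllTerminal-↠*⇒≈ : ∀ {D C} → D ↠* C → AllTerminal D → D ≈ C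
  AllTerminal-↠*⇒≈ ε ts = ε
  AllTerminal-↠*⇒≈ (inj₁ d ◅ ds) ts with AllTerminal-→P⇒≡ d ts
  ... | refl = AllTerminal-↠*⇒≈ ds ts
  AllTerminal-↠*⇒≈ (inj₂ d ◅ ds) ts = d ◅◅ AllTerminal-↠*⇒≈ ds (AllTerminal-≈ d ts)

  unique-terminal-distributions :
    DistributionConfluent → ∀ (a : A) (T₁ T₂ : 𝒯 a) → Maximal T₁ → Maximal T₂ → supp T₁ ≈ supp T₂
  unique-terminal-distributions confluent a T₁ T₂ m₁ m₂
    with confluent (↠*-supp₁ T₁) (↠*-supp₁ T₂)
  ... | C , T₁↠*C , T₂↠*C =
    AllTerminal-↠*⇒≈ T₁↠*C (Maximal⇒AllTerminal-supp T₁ m₁)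
      ◅◅ ≈-sym (AllTerminal-↠*⇒≈ T₂↠*C (Maximal⇒AllTerminal-supp T₂ m₂))

lemma3p7 : (R : Reals) (𝒜 : WithReals.PARS R) →
           let open WithReals R
               open PARS 𝒜
               open OnPARS 𝒜
           in DistributionConfluent →
              ∀ (a : A) (T₁ T₂ : 𝒯 a) → Maximal T₁ → Maximal T₂ →
              supp T₁ ≈ supp T₂
lemma3p7 R 𝒜 = Confluence.unique-terminal-distributions R 𝒜
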